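{- Let $D$ be a finite digraph with $n = |V(D)| \geq 1$ vertices. Then there is a digraph $D'$ containing $D$ as an induced subdigraph (i.e. $V(D) \subseteq V(D')$ and the edge relation of $D'$ restricted to $V(D)$ equals that of $D$) such that $D'$ is simple and $|V(D')| - |V(D)| \leq \lceil \log_4(n+1) \rceil$.
   Context: A digraph is a set $V$ with an arbitrary binary relation $\rightarrow$ on $V$ (no restrictions; so two vertices $u,v$ may satisfy $u\to v$, $v \to u$, both, or neither). An interval of a digraph is a set $I \subseteq V$ such that for all $x,y \in I$ and all $z \in V \setminus I$: $x \to z \iff y \to z$ and $z \to x \iff z \to y$. The empty set, singletons and $V$ are intervals; other intervals are proper. A digraph is simple if it has no proper intervals. -}

module Defs where

open import Data.Nat using (ℕ; zero; suc; _+_; _^_; _≤_; _≤?_)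
open import Data.Fin using (Fin)
open import Data.Bool using (Bool)
open import Data.Fin.Subset using (Subset; _∈_; _∉_)
open import Data.Product using (Σ; _×_; ∃)
open import Data.Sum using (_⊎_)
open import Relation.Binary.PropositionalEquality using (_≡_)
open import Relation.Nullary using (yes; no)
open import Function.Bundles using (_⇔_)

-- A finite digraph on the vertex set Fin n: an arbitrary (Bool-valued,
-- hence decidable) binary relation; loops and 2-cycles are allowed.
Digraph : ℕ → Set
Digraph n = Fin n → Fin n → Bool

IsInterval : ∀ {n} → Digraph n → Subset n → Set
IsInterval {n} D I =
  (x y z : Fin n) → x ∈ I → y ∈ I → z ∉ I →
  (D x z ≡ D y z) × (D z x ≡ D z y)

IsEmptySet : ∀ {n} → Subset n → Set
IsEmptySet {n} I = (x : Fin n) → x ∉ I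

IsSingleton : ∀ {n} → Subset n → Set
IsSingleton {n} I = Σ (Fin n) λ x → (y : Fin n) → (y ∈ I) ⇔ (y ≡ x)

IsFull : ∀ {n} → Subset n → Set
IsFull {n} I = (x : Fin n) → x ∈ I

IsSimple : ∀ {n} → Digraph n → Set
IsSimple {n} D =
  (I : Subset n) → IsInterval D I → IsEmptySet I ⊎ IsSingleton I ⊎ IsFull I

-- ⌈log₄ m⌉ for m ≥ 1: the least k with m ≤ 4^k.
-- search f m k returns the least j ≥ k (with at most f steps) such that m ≤ 4^j;
-- since m ≤ 4^m, fuel m starting from 0 suffices.
ceilLog4-search : ℕ → ℕ → ℕ → ℕ
ceilLog4-search zero m k = k
ceilLog4-search (suc f) m k with m ≤? 4 ^ k
... | yes _ = k
... | no _ = ceilLog4-search f m (suc k)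

ceilLog4 : ℕ → ℕ
ceilLog4 m = ceilLog4-search m m 0

module Submission where

-- Let K = ⌈log₄(n+1)⌉, so n < 4^K. Put K new vertices w₀, …, w_{K−1} on a directed path, which is
-- simple, and add the vertices of D to it one at a time. A vertex v being added keeps its arcs to
-- the vertices of D already present, while its arcs to the wⱼ are free and recorded by a code in
-- {0,1,2,3}^K. Adding v preserves simplicity unless v is a twin of an old vertex or the old
-- vertices form an interval, and each of these failures pins the code down: a twin of a vertex x
-- of D must copy the code of x, a twin of wⱼ must agree with the code of wⱼ off coordinate j, and
-- an interval forces a constant code. If twins of both kinds are possible, twins of all vertices
-- of D but one share a fixed coordinate. In every case fewer than 4^K codes are bad, so a good one
-- exists. For n ≤ 3 only one new vertex is allowed, too few for this count; there an extension is
-- found by exhaustive search.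

open import Defs
open import Data.Nat using (ℕ; zero; suc; _+_; _*_; _^_; _≤_; _<_; z≤n; s≤s)
open import Data.Nat.Properties
  using (≤-trans; ≤-refl; n≤1+n; +-comm; +-identityʳ; +-suc; +-monoʳ-≤; +-monoˡ-≤; +-mono-≤;
         *-monoʳ-≤; m^n>0; m≤m+n; m≤n+m; _≤?_; module ≤-Reasoning)
open import Data.Nat.Tactic.RingSolver using (solve-∀)
open import Data.Fin
  using (Fin; zero; suc; _↑ˡ_; _↑ʳ_; splitAt; combine; remQuot; funToFin; finToFun; punchIn; punchOut; _≟_)
open import Data.Fin.Properties
  using (all?; any?; ¬∀⟶∃¬; pigeonhole; <⇒≢; splitAt-↑ˡ; splitAt-↑ʳ; splitAt⁻¹-↑ˡ; splitAt⁻¹-↑ʳ;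
         ↑ˡ-injective; ↑ʳ-injective; remQuot-combine; funToFin-finToFin; finToFun-funToFin; punchIn-punchOut)
open import Data.Fin.Subset using (Subset; inside; outside)
open import Data.Fin.Subset.Properties using (drop-there)
open import Data.Vec using (Vec; []; _∷_; here; there; lookup; tabulate; map)
open import Data.Vec.Properties using (lookup∘tabulate)
open import Data.Vec.Functional using (Vector; _++_; updateAt; insertAt; removeAt)
open import Data.Vec.Functional.Properties
  using (lookup-++ˡ; lookup-++ʳ; updateAt-updates; updateAt-minimal; insertAt-lookup; insertAt-punchIn;
         removeAt-punchOut)
open import Data.Bool using (Bool; true; false)
open import Data.Bool.Properties using () renaming (_≟_ to _≟ᵇ_)
open import Data.Product using (Σ; _×_; _,_; proj₁; proj₂; ∃; curry; uncurry; map₂)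
open import Data.Sum using (_⊎_; inj₁; inj₂)
open import Data.Unit using (⊤; tt)
open import Data.Empty using (⊥-elim)
open import Relation.Nullary using (¬_; Dec; yes; no; contradiction)
open import Relation.Nullary.Decidable using (_×-dec_; _→-dec_; ¬?; map′; True; toWitness)
open import Relation.Binary.PropositionalEquality
  using (_≡_; _≢_; refl; sym; trans; cong; cong₂; cong-app; subst; _≗_; module ≡-Reasoning)
open import Function using (_∘_; const)
open import Function.Bundles using (mk⇔; Equivalence)

private
  variable
    m n K : ℕ

Trivial : Subset n → Set
Trivial I = IsEmptySet I ⊎ IsSingleton I ⊎ IsFull I

outside-isEmptySet : {I : Subset n} → IsEmptySet I → IsEmptySet (outside ∷ I)
outside-isEmptySet empty zero ()
outside-isEmptySet empty (suc x) = empty x ∘ drop-there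

inside-isSingleton : {I : Subset n} → IsEmptySet I → IsSingleton (inside ∷ I)
inside-isSingleton empty = zero , λ
  { zero    → mk⇔ (λ _ → refl) (λ _ → here)
  ; (suc y) → mk⇔ (⊥-elim ∘ empty y ∘ drop-there) (λ ()) }

outside-isSingleton : {I : Subset n} → IsSingleton I → IsSingleton (outside ∷ I)
outside-isSingleton (x , ∈⇔≡x) = suc x , λ
  { zero    → mk⇔ (λ ()) (λ ())
  ; (suc y) → mk⇔ (cong suc ∘ Equivalence.to (∈⇔≡x y) ∘ drop-there)
                  (λ { refl → there (Equivalence.from (∈⇔≡x x) refl) }) }

inside-isFull : {I : Subset n} → IsFull I → IsFull (inside ∷ I)
inside-isFull full zero    = here
inside-isFull full (suc x) = there (full x)

trivial₁ : (I : Subset 1) → Trivial I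
trivial₁ (outside ∷ []) = inj₁ (outside-isEmptySet λ ())
trivial₁ (inside  ∷ []) = inj₂ (inj₂ (inside-isFull λ ()))

trivial₂ : (I : Subset 2) → Trivial I
trivial₂ (outside ∷ outside ∷ []) = inj₁ (outside-isEmptySet (outside-isEmptySet λ ()))
trivial₂ (inside  ∷ outside ∷ []) = inj₂ (inj₁ (inside-isSingleton (outside-isEmptySet λ ())))
trivial₂ (outside ∷ inside  ∷ []) = inj₂ (inj₁ (outside-isSingleton (inside-isSingleton λ ())))
trivial₂ (inside  ∷ inside  ∷ []) = inj₂ (inj₂ (inside-isFull (inside-isFull λ ())))

digraph₁-isSimple : (D : Digraph 1) → IsSimple D
digraph₁-isSimple D I _ = trivial₁ I

digraph₂-isSimple : (D : Digraph 2) → IsSimple D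
digraph₂-isSimple D I _ = trivial₂ I

extend : Digraph n → (to from : Fin n → Bool) → (loop : Bool) → Digraph (suc n)
extend G to from loop zero    zero    = loop
extend G to from loop zero    (suc y) = to y
extend G to from loop (suc x) zero    = from x
extend G to from loop (suc x) (suc y) = G x y

Twin : Digraph n → (to from : Fin n → Bool) → Fin n → Set
Twin G to from y = ∀ z → z ≢ y → (to z ≡ G y z) × (from z ≡ G z y)

Constant : (Fin n → Bool) → Set
Constant f = ∀ z₁ z₂ → f z₁ ≡ f z₂

Distinguishing : Digraph n → (to from : Fin n → Bool) → Set
Distinguishing G to from = (∀ y → ¬ Twin G to from y) × ¬ (Constant to × Constant from)

module _ {G : Digraph n} {to from : Fin n → Bool} {loop : Bool} where

  ∷-isInterval : ∀ {b I} → IsInterval (extend G to from loop) (b ∷ I) → IsInterval G I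
  ∷-isInterval interval x y z x∈ y∈ z∉ =
    interval (suc x) (suc y) (suc z) (there x∈) (there y∈) (z∉ ∘ drop-there)

  inside-isInterval⇒twin : ∀ {I} → IsInterval (extend G to from loop) (inside ∷ I) →
                           (single : IsSingleton I) → Twin G to from (proj₁ single)
  inside-isInterval⇒twin interval (x , ∈⇔≡x) z z≢x =
    interval zero (suc x) (suc z) here (there (Equivalence.from (∈⇔≡x x) refl))
             (z≢x ∘ Equivalence.to (∈⇔≡x z) ∘ drop-there)

  outside-isInterval⇒constant : ∀ {I} → IsInterval (extend G to from loop) (outside ∷ I) →
                                IsFull I → Constant to × Constant from
  outside-isInterval⇒constant interval full =
    (λ z₁ z₂ → proj₂ (arcs z₁ z₂)) , (λ z₁ z₂ → proj₁ (arcs z₁ z₂))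
    where
    arcs = λ z₁ z₂ → interval (suc z₁) (suc z₂) zero (there (full z₁)) (there (full z₂)) (λ ())

  extend-isSimple : IsSimple G → Distinguishing G to from → IsSimple (extend G to from loop)
  extend-isSimple simple distinguishing (outside ∷ I) interval with simple I (∷-isInterval interval)
  ... | inj₁ empty         = inj₁ (outside-isEmptySet empty)
  ... | inj₂ (inj₁ single) = inj₂ (inj₁ (outside-isSingleton single))
  ... | inj₂ (inj₂ full)   = ⊥-elim (proj₂ distinguishing (outside-isInterval⇒constant interval full))
  extend-isSimple simple distinguishing (inside ∷ I) interval with simple I (∷-isInterval interval)
  ... | inj₁ empty         = inj₂ (inj₁ (inside-isSingleton empty))
  ... | inj₂ (inj₁ single) = ⊥-elim (proj₁ distinguishing _ (inside-isInterval⇒twin interval single))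
  ... | inj₂ (inj₂ full)   = inj₂ (inj₂ (inside-isFull full))

twin? : (G : Digraph n) (to from : Fin n → Bool) (y : Fin n) → Dec (Twin G to from y)
twin? G to from y = all? λ z → ¬? (z ≟ y) →-dec ((to z ≟ᵇ G y z) ×-dec (from z ≟ᵇ G z y))

constant? : (f : Fin n → Bool) → Dec (Constant f)
constant? f = all? λ z₁ → all? λ z₂ → f z₁ ≟ᵇ f z₂

distinguishing? : (G : Digraph n) (to from : Fin n → Bool) → Dec (Distinguishing G to from)
distinguishing? G to from = all? (¬? ∘ twin? G to from) ×-dec ¬? (constant? to ×-dec constant? from)

isZero : Fin n → Bool
isZero zero    = true
isZero (suc _) = false

-- The directed path 0 → 1 → ⋯ → k + 1.
dipath : ∀ k → Digraph (2 + k)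
dipath zero zero (suc zero) = true
dipath zero _    _          = false
dipath (suc k) = extend (dipath k) isZero (const false) false

dipath-0→1 : ∀ k → dipath k zero (suc zero) ≡ true
dipath-0→1 zero    = refl
dipath-0→1 (suc k) = refl

dipath-↛0 : ∀ k y → dipath k (suc y) zero ≡ false
dipath-↛0 zero    y = refl
dipath-↛0 (suc k) y = refl

dipath-isSimple : ∀ k → IsSimple (dipath k)
dipath-isSimple zero    = digraph₂-isSimple (dipath zero)
dipath-isSimple (suc k) =
  extend-isSimple (dipath-isSimple k) (noTwin , λ (constant , _) → notConstant constant)
  where
  noTwin : ∀ y → ¬ Twin (dipath k) isZero (const false) y
  noTwin zero    twin = contradiction (trans (proj₁ (twin (suc zero) λ ())) (dipath-0→1 k)) λ ()
  noTwin (suc y) twin = contradiction (trans (proj₁ (twin zero λ ())) (dipath-↛0 k y)) λ ()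
  notConstant : ¬ Constant (isZero {2 + k})
  notConstant constant = contradiction (constant zero (suc zero)) λ ()

↑ˡ≢↑ʳ : ∀ {m n} (x : Fin m) (j : Fin n) → x ↑ˡ n ≢ m ↑ʳ j
↑ˡ≢↑ʳ {m} {n} x j eq
  with trans (sym (splitAt-↑ˡ m x n)) (trans (cong (splitAt m) eq) (splitAt-↑ʳ m n j))
... | ()

data Split (m n : ℕ) : Fin (m + n) → Set where
  inLeft  : (x : Fin m) → Split m n (x ↑ˡ n)
  inRight : (j : Fin n) → Split m n (m ↑ʳ j)

split : ∀ m {n} (i : Fin (m + n)) → Split m n i
split m i with splitAt m i in eq
... | inj₁ x = subst (Split m _) (splitAt⁻¹-↑ˡ eq) (inLeft x)
... | inj₂ j = subst (Split m _) (splitAt⁻¹-↑ʳ eq) (inRight j)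

-- The arc pattern (u → v , v → u) between two vertices.
arcs : Bool → Bool → Fin 4
arcs false false = zero
arcs false true  = suc zero
arcs true  false = suc (suc zero)
arcs true  true  = suc (suc (suc zero))

arcTo arcFrom : Fin 4 → Bool
arcTo zero                = false
arcTo (suc zero)          = false
arcTo (suc (suc _))       = true
arcFrom zero                      = false
arcFrom (suc zero)                = true
arcFrom (suc (suc zero))          = false
arcFrom (suc (suc (suc _)))       = true

arcs-arcTo-arcFrom : ∀ a → arcs (arcTo a) (arcFrom a) ≡ a
arcs-arcTo-arcFrom zero                      = refl
arcs-arcTo-arcFrom (suc zero)                = refl
arcs-arcTo-arcFrom (suc (suc zero))          = refl
arcs-arcTo-arcFrom (suc (suc (suc zero)))    = refl

-- The arc patterns between a vertex and each of K fixed vertices.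
Code : ℕ → Set
Code K = Fin K → Fin 4

DistinguishingCode : Digraph (m + K) → (to from : Fin m → Bool) → Code K → Set
DistinguishingCode G to from c = Distinguishing G (to ++ arcTo ∘ c) (from ++ arcFrom ∘ c)

removeFirst : Digraph (suc n) → Digraph n
removeFirst D x y = D (suc x) (suc y)

arcsFromFirst arcsToFirst : Digraph (suc n) → Fin n → Bool
arcsFromFirst D y = D zero (suc y)
arcsToFirst   D y = D (suc y) zero

-- The vertices of D are attached to W one at a time; cs gives their codes towards W.
glue : Digraph m → Digraph K → Vec (Code K) m → Digraph (m + K)
glue D W []       = W
glue D W (c ∷ cs) =
  extend (glue (removeFirst D) W cs)
         (arcsFromFirst D ++ arcTo ∘ c) (arcsToFirst D ++ arcFrom ∘ c) (D zero zero)

glue-induces : (D : Digraph m) (W : Digraph K) (cs : Vec (Code K) m) →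
               ∀ x y → glue D W cs (x ↑ˡ K) (y ↑ˡ K) ≡ D x y
glue-induces D W (c ∷ cs) zero    zero    = refl
glue-induces D W (c ∷ cs) zero    (suc y) = lookup-++ˡ (arcsFromFirst D) (arcTo ∘ c) y
glue-induces D W (c ∷ cs) (suc x) zero    = lookup-++ˡ (arcsToFirst D) (arcFrom ∘ c) x
glue-induces D W (c ∷ cs) (suc x) (suc y) = glue-induces (removeFirst D) W cs x y

∃-∉-image : {N M : ℕ} (h : Fin N → Fin M) → N < M → ∃ λ e → ∀ i → h i ≢ e
∃-∉-image {N} {M} h N<M =
  map₂ curry (¬∀⟶∃¬ M (λ e → ∃ λ i → h i ≡ e) (λ e → any? λ i → h i ≟ e) notSurjective)
  where
  open ≡-Reasoning
  notSurjective : ¬ (∀ e → ∃ λ i → h i ≡ e)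
  notSurjective surjective with pigeonhole N<M (proj₁ ∘ surjective)
  ... | i , j , i<j , same = <⇒≢ i<j (begin
    i                       ≡⟨ sym (proj₂ (surjective i)) ⟩
    h (proj₁ (surjective i)) ≡⟨ cong h same ⟩
    h (proj₁ (surjective j)) ≡⟨ proj₂ (surjective j) ⟩
    j                       ∎)

funToFin-cong : {f g : Fin m → Fin n} → f ≗ g → funToFin f ≡ funToFin g
funToFin-cong {zero}  f≗g = refl
funToFin-cong {suc m} f≗g = cong₂ combine (f≗g zero) (funToFin-cong (f≗g ∘ suc))

single : Code K → Vector (Code K) 1
single c _ = c

constantCodes : Vector (Code K) 4
constantCodes v _ = v

infix 4 _∈ᶜ_
_∈ᶜ_ : Code K → Vector (Code K) n → Set
c ∈ᶜ cs = ∃ λ i → c ≗ cs i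

∃-∉ᶜ : (cs : Vector (Code K) n) → n < 4 ^ K → ∃ λ c → ¬ c ∈ᶜ cs
∃-∉ᶜ {K = K} cs n<4^K with ∃-∉-image (funToFin ∘ cs) n<4^K
... | e , notHit = finToFun e , λ (i , e≗csᵢ) →
  notHit i (trans (funToFin-cong (sym ∘ e≗csᵢ)) (funToFin-finToFin {K} {4} e))

∈ᶜ-++ˡ : {c : Code K} (cs : Vector (Code K) m) (ds : Vector (Code K) n) →
         c ∈ᶜ cs → c ∈ᶜ cs ++ ds
∈ᶜ-++ˡ cs ds (i , c≗csᵢ) =
  i ↑ˡ _ , λ j → trans (c≗csᵢ j) (cong-app (sym (lookup-++ˡ cs ds i)) j)

∈ᶜ-++ʳ : {c : Code K} (cs : Vector (Code K) m) (ds : Vector (Code K) n) →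
         c ∈ᶜ ds → c ∈ᶜ cs ++ ds
∈ᶜ-++ʳ {m = m} cs ds (i , c≗dsᵢ) =
  m ↑ʳ i , λ j → trans (c≗dsᵢ j) (cong-app (sym (lookup-++ʳ cs ds i)) j)

perturbation : (Fin K → Code K) → Fin K × Fin 4 → Code K
perturbation f (j , v) = updateAt (f j) j (const v)

-- For each j, the four codes that agree with f j away from coordinate j.
perturbations : (Fin K → Code K) → Vector (Code K) (K * 4)
perturbations f = perturbation f ∘ remQuot 4

∈ᶜ-perturbations : {c : Code K} (f : Fin K → Code K) (j : Fin K) →
                   (∀ j′ → j′ ≢ j → c j′ ≡ f j j′) → c ∈ᶜ perturbations f
∈ᶜ-perturbations {c = c} f j agree = combine j (c j) , λ j′ →
  trans (perturbed j′) (cong (λ p → perturbation f p j′) (sym (remQuot-combine j (c j))))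
  where
  perturbed : ∀ j′ → c j′ ≡ perturbation f (j , c j) j′
  perturbed j′ with j′ ≟ j
  ... | yes refl = sym (updateAt-updates j (f j))
  ... | no j′≢j  = trans (agree j′ j′≢j) (sym (updateAt-minimal j′ j (f j) j′≢j))

withCoordinate : Fin (suc K) → Fin 4 → Vector (Code (suc K)) (4 ^ K)
withCoordinate i v e = insertAt (finToFun e) i v

∈ᶜ-withCoordinate : {c : Code (suc K)} {i : Fin (suc K)} {v : Fin 4} →
                    c i ≡ v → c ∈ᶜ withCoordinate i v
∈ᶜ-withCoordinate {c = c} {i} {v} cᵢ≡v = e , coordinate
  where
  open ≡-Reasoning
  e = funToFin (removeAt c i)
  coordinate : ∀ j → c j ≡ insertAt (finToFun e) i v j
  coordinate j with i ≟ j
  ... | yes refl = trans cᵢ≡v (sym (insertAt-lookup (finToFun e) i v))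
  ... | no i≢j = begin
    c j                                                  ≡⟨ sym (removeAt-punchOut c i≢j) ⟩
    removeAt c i (punchOut i≢j)                          ≡⟨ sym (finToFun-funToFin (removeAt c i) _) ⟩
    finToFun e (punchOut i≢j)                            ≡⟨ sym (insertAt-punchIn (finToFun e) i v _) ⟩
    insertAt (finToFun e) i v (punchIn i (punchOut i≢j))
      ≡⟨ cong (insertAt (finToFun e) i v) (punchIn-punchOut i≢j) ⟩
    insertAt (finToFun e) i v j                          ∎

n<4^n : ∀ n → n < 4 ^ n
n<4^n zero    = s≤s z≤n
n<4^n (suc n) = ≤-trans (+-mono-≤ (m^n>0 4 n) (n<4^n n)) (+-monoʳ-≤ (4 ^ n) (m≤m+n (4 ^ n) _))

room-for-codes : ∀ k → 2 + (4 ^ suc k + (2 + k) * 4) < 4 ^ (2 + k)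
room-for-codes k = begin
  3 + (4 * a + (2 + k) * 4)     ≡⟨ rearrange a k ⟩
  4 * a + (4 * suc k + 7)       ≤⟨ +-monoʳ-≤ (4 * a) (+-mono-≤ (*-monoʳ-≤ 4 (n<4^n k)) 7≤8*a) ⟩
  4 * a + (4 * a + 8 * a)       ≡⟨ collect a ⟩
  4 * (4 * a)                   ∎
  where
  open ≤-Reasoning
  a = 4 ^ k
  7≤8*a : 7 ≤ 8 * a
  7≤8*a = ≤-trans (n≤1+n 7) (*-monoʳ-≤ 8 (m^n>0 4 k))
  rearrange : ∀ a k → 3 + (4 * a + (2 + k) * 4) ≡ 4 * a + (4 * suc k + 7)
  rearrange = solve-∀
  collect : ∀ a → 4 * a + (4 * a + 8 * a) ≡ 4 * (4 * a)
  collect = solve-∀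

room-for-perturbations : ∀ k → 4 + (2 + k) * 4 < 4 ^ (2 + k)
room-for-perturbations k = ≤-trans (s≤s (s≤s (s≤s (+-monoˡ-≤ ((2 + k) * 4) 2≤4^1+k)))) (room-for-codes k)
  where
  2≤4^1+k : 2 ≤ 4 ^ suc k
  2≤4^1+k = ≤-trans (s≤s (s≤s z≤n)) (*-monoʳ-≤ 4 (m^n>0 4 k))

module _ {m k} (G : Digraph (m + (2 + k))) (to from : Fin m → Bool) where

  private
    left : Fin m → Fin (m + (2 + k))
    left x = x ↑ˡ (2 + k)

    right : Fin (2 + k) → Fin (m + (2 + k))
    right j = m ↑ʳ j

    toAll fromAll : Code (2 + k) → Fin (m + (2 + k)) → Bool
    toAll   c = to ++ arcTo ∘ c
    fromAll c = from ++ arcFrom ∘ c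

    codeOf : Fin (m + (2 + k)) → Code (2 + k)
    codeOf y j = arcs (G y (right j)) (G (right j) y)

    AgreesOnLeft : Fin (m + (2 + k)) → Set
    AgreesOnLeft y = ∀ x → left x ≢ y → (to x ≡ G y (left x)) × (from x ≡ G (left x) y)

    agreesOnLeft? : ∀ y → Dec (AgreesOnLeft y)
    agreesOnLeft? y =
      all? λ x → ¬? (left x ≟ y) →-dec ((to x ≟ᵇ G y (left x)) ×-dec (from x ≟ᵇ G (left x) y))

    Bad : Code (2 + k) → Set
    Bad c = (∃ λ y → Twin G (toAll c) (fromAll c) y) ⊎ (Constant (toAll c) × Constant (fromAll c))

    code-via-arcs : ∀ c j → c j ≡ arcs (toAll c (right j)) (fromAll c (right j))
    code-via-arcs c j = trans (sym (arcs-arcTo-arcFrom (c j)))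
      (sym (cong₂ arcs (lookup-++ʳ to (arcTo ∘ c) j) (lookup-++ʳ from (arcFrom ∘ c) j)))

    twin⇒codeOf : ∀ {c y} → Twin G (toAll c) (fromAll c) y → ∀ j → right j ≢ y → c j ≡ codeOf y j
    twin⇒codeOf {c} twin j j≢y =
      trans (code-via-arcs c j) (cong₂ arcs (proj₁ (twin _ j≢y)) (proj₂ (twin _ j≢y)))

    twin⇒agreesOnLeft : ∀ {c y} → Twin G (toAll c) (fromAll c) y → AgreesOnLeft y
    twin⇒agreesOnLeft {c} twin x x≢y =
      trans (sym (lookup-++ˡ to (arcTo ∘ c) x)) (proj₁ (twin _ x≢y)) ,
      trans (sym (lookup-++ˡ from (arcFrom ∘ c) x)) (proj₂ (twin _ x≢y))

    constant⇒≗ : ∀ {c} → Constant (toAll c) × Constant (fromAll c) →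
                 ∀ y j → c j ≡ arcs (toAll c y) (fromAll c y)
    constant⇒≗ {c} (constantTo , constantFrom) y j =
      trans (code-via-arcs c j) (cong₂ arcs (constantTo (right j) y) (constantFrom (right j) y))

    constant⇒≗left : ∀ {c} → Constant (toAll c) × Constant (fromAll c) →
                     ∀ x j → c j ≡ arcs (to x) (from x)
    constant⇒≗left {c} constant x j = trans (constant⇒≗ constant (left x) j)
      (cong₂ arcs (lookup-++ˡ to (arcTo ∘ c) x) (lookup-++ˡ from (arcFrom ∘ c) x))

    twin⇒coordinate : ∀ {c x₀ i x} → AgreesOnLeft (left x₀) → AgreesOnLeft (right i) → x ≢ x₀ →
                      Twin G (toAll c) (fromAll c) (left x) → c i ≡ arcs (to x₀) (from x₀)
    twin⇒coordinate {c} {x₀} {i} {x} agrees₀ agreesᵢ x≢x₀ twin = begin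
      c i                                                ≡⟨ twin⇒codeOf twin i (↑ˡ≢↑ʳ x i ∘ sym) ⟩
      arcs (G (left x) (right i)) (G (right i) (left x)) ≡⟨ sym (cong₂ arcs (proj₂ viaᵢ) (proj₁ viaᵢ)) ⟩
      arcs (from x) (to x)                               ≡⟨ cong₂ arcs (proj₂ via₀) (proj₁ via₀) ⟩
      arcs (G (left x) (left x₀)) (G (left x₀) (left x)) ≡⟨ sym (cong₂ arcs (proj₁ viaₓ) (proj₂ viaₓ)) ⟩
      arcs (to x₀) (from x₀)                             ∎
      where
      open ≡-Reasoning
      viaᵢ = agreesᵢ x (↑ˡ≢↑ʳ x i)
      via₀ = agrees₀ x (x≢x₀ ∘ ↑ˡ-injective (2 + k) x x₀)
      viaₓ = twin⇒agreesOnLeft twin x₀ (x≢x₀ ∘ sym ∘ ↑ˡ-injective (2 + k) x₀ x)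

    twinLeft⇒≗codeOf : ∀ {c x} → Twin G (toAll c) (fromAll c) (left x) → c ≗ codeOf (left x)
    twinLeft⇒≗codeOf {x = x} twin j = twin⇒codeOf twin j (↑ˡ≢↑ʳ x j ∘ sym)

    twinRight⇒∈ᶜperturbations : ∀ {c j} → Twin G (toAll c) (fromAll c) (right j) →
                                c ∈ᶜ perturbations (codeOf ∘ right)
    twinRight⇒∈ᶜperturbations {j = j} twin =
      ∈ᶜ-perturbations (codeOf ∘ right) j λ j′ j′≢j →
        twin⇒codeOf twin j′ (j′≢j ∘ ↑ʳ-injective m j′ j)

    profiles : Vector (Code (2 + k)) m
    profiles = codeOf ∘ left

    nearRight : Vector (Code (2 + k)) ((2 + k) * 4)
    nearRight = perturbations (codeOf ∘ right)

    Covers : Vector (Code (2 + k)) n → Set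
    Covers cs = ∀ {c} → Bad c → c ∈ᶜ cs

    covered-by-perturbations : ¬ ∃ (AgreesOnLeft ∘ left) → Covers (constantCodes ++ nearRight)
    covered-by-perturbations noLeft (inj₁ (y , twin)) with split m y
    ... | inLeft x  = ⊥-elim (noLeft (x , twin⇒agreesOnLeft twin))
    ... | inRight j = ∈ᶜ-++ʳ constantCodes nearRight (twinRight⇒∈ᶜperturbations twin)
    covered-by-perturbations noLeft (inj₂ constant) =
      ∈ᶜ-++ˡ constantCodes nearRight (_ , constant⇒≗ constant (right zero))

    covered-by-profiles : ∀ x₀ → ¬ ∃ (AgreesOnLeft ∘ right) →
                          Covers (single (const (arcs (to x₀) (from x₀))) ++ profiles)
    covered-by-profiles x₀ noRight (inj₁ (y , twin)) with split m y
    ... | inLeft x  = ∈ᶜ-++ʳ (single _) profiles (x , twinLeft⇒≗codeOf twin)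
    ... | inRight j = ⊥-elim (noRight (j , twin⇒agreesOnLeft twin))
    covered-by-profiles x₀ noRight (inj₂ constant) =
      ∈ᶜ-++ˡ (single _) profiles (zero , constant⇒≗left constant x₀)

    covered-by-coordinate : ∀ {x₀ i} → AgreesOnLeft (left x₀) → AgreesOnLeft (right i) →
      let r₀ = arcs (to x₀) (from x₀) in
      Covers (single (codeOf (left x₀)) ++ single (const r₀) ++ withCoordinate i r₀ ++ nearRight)
    covered-by-coordinate {x₀} {i} agrees₀ agreesᵢ (inj₁ (y , twin)) with split m y
    ... | inRight j = ∈ᶜ-++ʳ (single _) _ (∈ᶜ-++ʳ (single _) _
                        (∈ᶜ-++ʳ (withCoordinate i _) nearRight (twinRight⇒∈ᶜperturbations twin)))
    ... | inLeft x with x ≟ x₀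
    ...   | yes refl = ∈ᶜ-++ˡ (single _) _ (zero , twinLeft⇒≗codeOf twin)
    ...   | no x≢x₀  = ∈ᶜ-++ʳ (single _) _ (∈ᶜ-++ʳ (single _) _
                         (∈ᶜ-++ˡ (withCoordinate i _) nearRight
                           (∈ᶜ-withCoordinate (twin⇒coordinate agrees₀ agreesᵢ x≢x₀ twin))))
    covered-by-coordinate {x₀} agrees₀ agreesᵢ (inj₂ constant) =
      ∈ᶜ-++ʳ (single _) _ (∈ᶜ-++ˡ (single _) _ (zero , constant⇒≗left constant x₀))

    covered⇒∃-distinguishing : {cs : Vector (Code (2 + k)) n} → n < 4 ^ (2 + k) → Covers cs →
                               ∃ (DistinguishingCode G to from)
    covered⇒∃-distinguishing {cs = cs} room covers with ∃-∉ᶜ cs room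
    ... | c , c∉cs = c , (λ y twin → c∉cs (covers (inj₁ (y , twin)))) , c∉cs ∘ covers ∘ inj₂

  -- Which codes can be bad depends on which vertices look like the added one from the left.
  ∃-distinguishingCode : suc m < 4 ^ (2 + k) → ∃ (DistinguishingCode G to from)
  ∃-distinguishingCode room with any? (agreesOnLeft? ∘ left)
  ... | no noLeft = covered⇒∃-distinguishing (room-for-perturbations k) (covered-by-perturbations noLeft)
  ... | yes (x₀ , agrees₀) with any? (agreesOnLeft? ∘ right)
  ...   | no noRight        = covered⇒∃-distinguishing room (covered-by-profiles x₀ noRight)
  ...   | yes (i , agreesᵢ) =
    covered⇒∃-distinguishing (room-for-codes k) (covered-by-coordinate agrees₀ agreesᵢ)

∃-simple-glue : ∀ {n k} → n < 4 ^ (2 + k) → (D : Digraph n) →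
                ∃ λ (cs : Vec (Code (2 + k)) n) → IsSimple (glue D (dipath k) cs)
∃-simple-glue {zero}  {k} _    D = [] , dipath-isSimple k
∃-simple-glue {suc n} {k} room D with ∃-simple-glue (≤-trans (n≤1+n _) room) (removeFirst D)
... | cs , simple
  with ∃-distinguishingCode (glue (removeFirst D) (dipath k) cs) (arcsFromFirst D) (arcsToFirst D) room
... | c , distinguishing = c ∷ cs , extend-isSimple simple distinguishing

SimpleExtension : ℕ → Digraph n → Set
SimpleExtension {n} k D =
  Σ (Digraph (n + k)) λ D′ → ((x y : Fin n) → D′ (x ↑ˡ k) (y ↑ˡ k) ≡ D x y) × IsSimple D′

simpleExtension : 2 ≤ K → n < 4 ^ K → (D : Digraph n) → SimpleExtension K D
simpleExtension {suc (suc k)} (s≤s (s≤s _)) room D with ∃-simple-glue room D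
... | cs , simple = glue D (dipath k) cs , glue-induces D (dipath k) cs , simple

apex : Digraph 1
apex _ _ = false

-- No condition on the first attached vertex: together with the apex it forms a 2-vertex digraph.
Admissible : Digraph n → Vec (Code 1) n → Set
Admissible D []               = ⊤
Admissible D (c ∷ [])         = ⊤
Admissible D (c ∷ cs@(_ ∷ _)) =
  DistinguishingCode (glue (removeFirst D) apex cs) (arcsFromFirst D) (arcsToFirst D) c
  × Admissible (removeFirst D) cs

admissible? : (D : Digraph n) (cs : Vec (Code 1) n) → Dec (Admissible D cs)
admissible? D []               = yes tt
admissible? D (c ∷ [])         = yes tt
admissible? D (c ∷ cs@(_ ∷ _)) = distinguishing? _ _ _ ×-dec admissible? (removeFirst D) cs

admissible-isSimple : (D : Digraph n) (cs : Vec (Code 1) n) → Admissible D cs → IsSimple (glue D apex cs)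
admissible-isSimple D []               _                   = digraph₁-isSimple apex
admissible-isSimple D (c ∷ [])         _                   = digraph₂-isSimple _
admissible-isSimple D (c ∷ cs@(_ ∷ _)) (distinguishing , admissible) =
  extend-isSimple (admissible-isSimple (removeFirst D) cs admissible) distinguishing

table : Vec Bool (n * n) → Digraph n
table t x y = lookup t (combine x y)

tableOf : Digraph n → Vec Bool (n * n)
tableOf {n} D = tabulate (uncurry D ∘ remQuot n)

table-tableOf : (D : Digraph n) → ∀ x y → table (tableOf D) x y ≡ D x y
table-tableOf D x y = trans (lookup∘tabulate _ (combine x y)) (cong (uncurry D) (remQuot-combine x y))

∀-vec? : {P : Vec Bool n → Set} → (∀ v → Dec (P v)) → Dec (∀ v → P v)
∀-vec? {zero}  P? = map′ (λ p → λ { [] → p }) (λ all → all []) (P? [])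
∀-vec? {suc n} P? = map′ (λ (ps , qs) → λ { (true ∷ v) → ps v ; (false ∷ v) → qs v })
                         (λ all → all ∘ (true ∷_) , all ∘ (false ∷_))
                         (∀-vec? (P? ∘ (true ∷_)) ×-dec ∀-vec? (P? ∘ (false ∷_)))

∃-vec? : {P : Vec (Fin 4) n → Set} → (∀ v → Dec (P v)) → Dec (∃ P)
∃-vec? {zero}  P? = map′ ([] ,_) (λ { ([] , p) → p }) (P? [])
∃-vec? {suc n} P? = map′ (λ (a , v , p) → a ∷ v , p) (λ { (a ∷ v , p) → a , v , p })
                         (any? λ a → ∃-vec? (P? ∘ (a ∷_)))

apexCodes : Vec (Fin 4) n → Vec (Code 1) n
apexCodes = map const

oneVertexSearch : ∀ n → Dec (∀ t → ∃ λ v → Admissible (table {n} t) (apexCodes v))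
oneVertexSearch n = ∀-vec? λ t → ∃-vec? λ v → admissible? (table t) (apexCodes v)

oneVertexExtension : ∀ n → True (oneVertexSearch n) → (D : Digraph n) → SimpleExtension 1 D
oneVertexExtension n found D with toWitness found (tableOf D)
... | e , admissible = glue (table (tableOf D)) apex (apexCodes e) ,
  (λ x y → trans (glue-induces (table (tableOf D)) apex (apexCodes e) x y) (table-tableOf D x y)) ,
  admissible-isSimple _ _ admissible

-- Kept abstract so that the type checker never unfolds the exhaustive search at use sites.
abstract
  oneVertexExtension₂ : (D : Digraph 2) → SimpleExtension 1 D
  oneVertexExtension₂ = oneVertexExtension 2 _

  oneVertexExtension₃ : (D : Digraph 3) → SimpleExtension 1 D
  oneVertexExtension₃ = oneVertexExtension 3 _

ceilLog4-search-≥ : ∀ f m j → j ≤ ceilLog4-search f m j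
ceilLog4-search-≥ zero    m j = ≤-refl
ceilLog4-search-≥ (suc f) m j with m ≤? 4 ^ j
... | yes _ = ≤-refl
... | no  _ = ≤-trans (n≤1+n j) (ceilLog4-search-≥ f m (suc j))

ceilLog4-search-bound : ∀ f m j → m ≤ 4 ^ (j + f) → m ≤ 4 ^ ceilLog4-search f m j
ceilLog4-search-bound zero    m j m≤4^j = subst (λ i → m ≤ 4 ^ i) (+-identityʳ j) m≤4^j
ceilLog4-search-bound (suc f) m j m≤4^j+f with m ≤? 4 ^ j
... | yes m≤4^j = m≤4^j
... | no  _     = ceilLog4-search-bound f m (suc j) (subst (λ i → m ≤ 4 ^ i) (+-suc j f) m≤4^j+f)

<4^ceilLog4 : ∀ n → n < 4 ^ ceilLog4 (n + 1)
<4^ceilLog4 n = subst (_≤ 4 ^ ceilLog4 (n + 1)) (+-comm n 1)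
  (ceilLog4-search-bound (n + 1) (n + 1) 0 (≤-trans (n≤1+n (n + 1)) (n<4^n (n + 1))))

2≤ceilLog4 : ∀ m → 5 ≤ m → 2 ≤ ceilLog4 m
2≤ceilLog4 (suc (suc (suc (suc (suc m))))) (s≤s (s≤s (s≤s (s≤s (s≤s _))))) =
  ceilLog4-search-≥ (3 + m) (5 + m) 2

theorem6p1 : (n : ℕ) → 1 ≤ n → (D : Digraph n) →
    Σ ℕ λ k → Σ (Digraph (n + k)) λ D′ →
      ((x y : Fin n) → D′ ((x ↑ˡ k)) ((y ↑ˡ k)) ≡ D x y)
      × IsSimple D′
      × k ≤ ceilLog4 (n + 1)
theorem6p1 1 _ D = 0 , D , (λ { zero zero → refl }) , digraph₁-isSimple D , z≤n
theorem6p1 2 _ D with oneVertexExtension₂ D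
... | D′ , induced , simple = 1 , D′ , induced , simple , s≤s z≤n
theorem6p1 3 _ D with oneVertexExtension₃ D
... | D′ , induced , simple = 1 , D′ , induced , simple , s≤s z≤n
theorem6p1 n@(suc (suc (suc (suc n′)))) _ D
  with simpleExtension (2≤ceilLog4 (n + 1) (s≤s (s≤s (s≤s (s≤s (m≤n+m 1 n′)))))) (<4^ceilLog4 n) D
... | D′ , induced , simple = _ , D′ , induced , simple , ≤-refl
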